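{- If $G$ is a connected $6$-$\gamma_{tR}$-edge-supercritical graph with $\operatorname{diam}(G)=2$, then $G$ is both $3$-$\gamma_t$-edge-critical and $3$-$\gamma$-edge-critical.
   Context: All graphs are finite and simple. $\gamma(G)$ is the minimum size of a dominating set (a set $S$ such that every vertex outside $S$ has a neighbour in $S$); for $G$ with no isolated vertices, $\gamma_t(G)$ is the minimum size of a total dominating set (a set $T$ such that every vertex of $G$ has a neighbour in $T$). A total Roman dominating function (TRD-function) on a graph $G$ with no isolated vertices is a function $f:V(G)\to\{0,1,2\}$ such that every vertex $v$ with $f(v)=0$ is adjacent to some $u$ with $f(u)=2$, and the subgraph induced by $\{w:f(w)>0\}$ has no isolated vertices; its weight is $\sum_v f(v)$ and $\gamma_{tR}(G)$ is the minimum weight. $G$ is $k$-$\gamma_{tR}$-edge-supercritical if $\gamma_{tR}(G)=k$, $E(\overline{G})\neq\emptyset$ and $\gamma_{tR}(G+e)\leq\gamma_{tR}(G)-2$ for every $e\in E(\overline{G})$. $G$ is $k$-$\gamma_t$-edge-critical (resp. $k$-$\gamma$-edge-critical) if $\gamma_t(G)=k$ (resp. $\gamma(G)=k$), $E(\overline{G})\neq\emptyset$, and $\gamma_t(G+e)<\gamma_t(G)$ (resp. $\gamma(G+e)<\gamma(G)$) for every $e\in E(\overline{G})$. -}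

module Defs where

open import Data.Nat using (ℕ; zero; suc; _+_; _∸_; _≤_; _<_)
open import Data.Fin using (Fin; zero; suc; toℕ)
open import Data.Bool using (Bool; true; false; if_then_else_)
open import Data.Product using (Σ; ∃; ∃-syntax; _×_; _,_)
open import Data.Sum using (_⊎_; inj₁; inj₂)
open import Data.Empty using (⊥)
open import Relation.Nullary using (¬_)
open import Relation.Binary.PropositionalEquality using (_≡_; refl; sym; trans)

record Graph : Set₁ where
  field
    n      : ℕ
    Adj    : Fin n → Fin n → Set
    symm   : ∀ {u v} → Adj u v → Adj v u
    irrefl : ∀ {v} → ¬ Adj v v
open Graph public

V : Graph → Set
V G = Fin (n G)

NonEdge : (G : Graph) → V G → V G → Set
NonEdge G u v = ¬ (u ≡ v) × ¬ Adj G u v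

ComplementNonEmpty : Graph → Set
ComplementNonEmpty G = ∃[ u ] ∃[ v ] NonEdge G u v

addEdge : (G : Graph) (u v : V G) → ¬ (u ≡ v) → Graph
addEdge G u v u≢v = record
  { n      = n G
  ; Adj    = A
  ; symm   = sy
  ; irrefl = ir
  }
  where
  A : V G → V G → Set
  A x y = Adj G x y ⊎ ((x ≡ u × y ≡ v) ⊎ (x ≡ v × y ≡ u))
  sy : ∀ {x y} → A x y → A y x
  sy (inj₁ a)              = inj₁ (symm G a)
  sy (inj₂ (inj₁ (p , q))) = inj₂ (inj₂ (q , p))
  sy (inj₂ (inj₂ (p , q))) = inj₂ (inj₁ (q , p))
  ir : ∀ {x} → ¬ A x x
  ir (inj₁ a)              = irrefl G a
  ir (inj₂ (inj₁ (p , q))) = u≢v (trans (sym p) q)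
  ir (inj₂ (inj₂ (p , q))) = u≢v (trans (sym q) p)

-- WithinDist G k u v : there is a walk of length at most k from u to v,
-- i.e. d(u,v) ≤ k.
data WithinDist (G : Graph) : ℕ → V G → V G → Set where
  here : ∀ {k v} → WithinDist G k v v
  step : ∀ {k u w v} → Adj G u w → WithinDist G k w v → WithinDist G (suc k) u v

Connected : Graph → Set
Connected G = ∀ u v → ∃[ k ] WithinDist G k u v

-- diam(G) = d  (for d ≥ 1): every pair is at distance ≤ d, and some pair is
-- at distance > d - 1, i.e. exactly d.
Diam≡ : Graph → ℕ → Set
Diam≡ G d = (∀ u v → WithinDist G d u v)
          × (∃[ u ] ∃[ v ] ¬ WithinDist G (d ∸ 1) u v)

sumF : ∀ {m} → (Fin m → ℕ) → ℕ
sumF {zero}  f = 0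
sumF {suc m} f = f zero + sumF (λ i → f (suc i))

VSet : Graph → Set
VSet G = V G → Bool

size : (G : Graph) → VSet G → ℕ
size G S = sumF (λ i → if S i then 1 else 0)

Mem : (G : Graph) → V G → VSet G → Set
Mem G x S = S x ≡ true

IsDominating : (G : Graph) → VSet G → Set
IsDominating G S = ∀ v → Mem G v S ⊎ (∃[ u ] (Mem G u S × Adj G v u))

IsTotalDominating : (G : Graph) → VSet G → Set
IsTotalDominating G S = ∀ v → ∃[ u ] (Mem G u S × Adj G v u)

NoIsolated : Graph → Set
NoIsolated G = ∀ v → ∃[ u ] Adj G v u

γ≡ : Graph → ℕ → Set
γ≡ G k = (∃[ S ] (IsDominating G S × size G S ≡ k))
       × (∀ S → IsDominating G S → k ≤ size G S)

γ< : Graph → ℕ → Set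
γ< G k = ∃[ S ] (IsDominating G S × size G S < k)

γt≡ : Graph → ℕ → Set
γt≡ G k = (∃[ S ] (IsTotalDominating G S × size G S ≡ k))
        × (∀ S → IsTotalDominating G S → k ≤ size G S)

γt< : Graph → ℕ → Set
γt< G k = ∃[ S ] (IsTotalDominating G S × size G S < k)

-- f : V → {0,1,2}, represented by Fin 3 (value = toℕ)
IsTRDF : (G : Graph) → (V G → Fin 3) → Set
IsTRDF G f =
    (∀ v → toℕ (f v) ≡ 0 → ∃[ u ] (Adj G v u × toℕ (f u) ≡ 2))
  × (∀ w → 0 < toℕ (f w) → ∃[ u ] (Adj G w u × 0 < toℕ (f u)))

weight : ∀ {G} → (V G → Fin 3) → ℕ
weight f = sumF (λ v → toℕ (f v))

γtR≡ : Graph → ℕ → Set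
γtR≡ G k = (∃[ f ] (IsTRDF G f × weight {G} f ≡ k))
         × (∀ f → IsTRDF G f → k ≤ weight {G} f)

γtR≤ : Graph → ℕ → Set
γtR≤ G k = ∃[ f ] (IsTRDF G f × weight {G} f ≤ k)

TRSupercritical : ℕ → Graph → Set
TRSupercritical k G =
    NoIsolated G
  × γtR≡ G k
  × ComplementNonEmpty G
  × (∀ u v (ne : NonEdge G u v) →
       γtR≤ (addEdge G u v (Data.Product.proj₁ ne)) (k ∸ 2))

TotalCritical : ℕ → Graph → Set
TotalCritical k G =
    NoIsolated G
  × γt≡ G k
  × ComplementNonEmpty G
  × (∀ u v (ne : NonEdge G u v) → γt< (addEdge G u v (Data.Product.proj₁ ne)) k)

DomCritical : ℕ → Graph → Set
DomCritical k G =
    γ≡ G k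
  × ComplementNonEmpty G
  × (∀ u v (ne : NonEdge G u v) → γ< (addEdge G u v (Data.Product.proj₁ ne)) k)

-- A dominating set {a, b} of G would yield a total Roman dominating function of weight at most 5:
-- put 2 on a and b, and 1 on a common neighbour when a and b are at distance 2. Since
-- γ_tR(G) = 6, this gives γ(G) ≥ 3, hence γ_t(G) ≥ 3. Conversely, for a non-edge e a TRD-function
-- of G + e of weight 4 must vanish somewhere (otherwise it is a TRD-function of G), so it has a
-- vertex of value 2; weight counting shows that the vertices of value 2, completed by a positive
-- neighbour if there is only one of them, form a total dominating pair of G + e. Thus
-- γ_t(G + e) ≤ 2, and adding a common neighbour of the ends of e (diam G = 2) turns such a pair
-- into a total dominating set of G of size 3.

module Submission where

open import Defs
open import Data.Bool using (Bool; true; false; if_then_else_) renaming (_≟_ to _≟ᵇ_)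
open import Data.Empty using (⊥; ⊥-elim)
open import Data.Fin using (Fin; zero; suc; toℕ; _≟_)
open import Data.Fin.Patterns using (0F; 1F; 2F)
open import Data.Fin.Properties using (any?; toℕ≤pred[n])
open import Data.List using (List; []; _∷_; _++_; map; length)
open import Data.List.Properties using (map-++)
open import Data.List.Membership.Propositional using (_∈_; _∉_)
open import Data.List.Membership.Propositional.Properties using (∈-++⁺ˡ; ∈-++⁺ʳ)
open import Data.List.Relation.Unary.All as All using (All; []; _∷_)
open import Data.List.Relation.Unary.Any as Any using (here; there)
open import Data.List.Relation.Unary.Unique.Propositional using (Unique; []; _∷_)
open import Data.List.Relation.Binary.Subset.Propositional using (_⊆_)
open import Data.Nat using (ℕ; zero; suc; _+_; _*_; _≤_; _<_; z≤n; s≤s; _≤?_)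
  renaming (_≟_ to _≟ℕ_)
open import Data.Nat.ListAction using (sum)
open import Data.Nat.ListAction.Properties using (sum-++)
open import Data.Nat.Properties
  using (≤-refl; ≤-trans; ≤-reflexive; ≤-antisym; ≤-pred; ≤⇒≯; ≰⇒>; +-mono-≤; +-monoʳ-≤;
         n≢0⇒n>0; n>0⇒n≢0; n≤1+n; *-identityʳ; +-commutativeSemigroup; module ≤-Reasoning)
open import Algebra.Properties.CommutativeSemigroup +-commutativeSemigroup using (x∙yz≈y∙xz)
open import Data.Product using (∃-syntax; ∃₂; _×_; _,_; proj₁; proj₂)
open import Data.Sum using (_⊎_; inj₁; inj₂)
open import Data.Vec.Functional using (updateAt)
open import Data.Vec.Functional.Properties using (updateAt-updates; updateAt-minimal)
open import Function using (const; flip; _∘_)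
open import Relation.Nullary using (¬_; Dec; yes; no; does; contradiction; ¬?)
open import Relation.Nullary.Decidable using (dec-true; dec-false; _×-dec_)
open import Relation.Binary.PropositionalEquality
  using (_≡_; _≢_; refl; sym; trans; cong; cong₂; subst; ≢-sym; module ≡-Reasoning)

private variable
  m : ℕ

sumF-zero : {g : Fin m → ℕ} → (∀ i → g i ≡ 0) → sumF g ≡ 0
sumF-zero {zero}  g≡0 = refl
sumF-zero {suc m} g≡0 = cong₂ _+_ (g≡0 zero) (sumF-zero (g≡0 ∘ suc))

sumF-split : (g : Fin m → ℕ) (a : Fin m) → sumF g ≡ g a + sumF (updateAt g a (const 0))
sumF-split g zero    = refl
sumF-split g (suc a) = begin
  g zero + sumF (g ∘ suc)                                       ≡⟨ cong (g zero +_) (sumF-split (g ∘ suc) a) ⟩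
  g zero + (g (suc a) + sumF (updateAt (g ∘ suc) a (const 0)))  ≡⟨ x∙yz≈y∙xz (g zero) (g (suc a)) _ ⟩
  g (suc a) + (g zero + sumF (updateAt (g ∘ suc) a (const 0)))  ∎
  where open ≡-Reasoning

updateAt-0-≤ : (g : Fin m → ℕ) (a i : Fin m) → updateAt g a (const 0) i ≤ g i
updateAt-0-≤ g a i with i ≟ a
... | yes refl = ≤-trans (≤-reflexive (updateAt-updates a g)) z≤n
... | no i≢a   = ≤-reflexive (updateAt-minimal i a g i≢a)

sum-map-mono : {g h : Fin m → ℕ} {xs : List (Fin m)} → All (λ i → g i ≤ h i) xs →
               sum (map g xs) ≤ sum (map h xs)
sum-map-mono []           = z≤n
sum-map-mono (g≤h ∷ rest) = +-mono-≤ g≤h (sum-map-mono rest)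

sum-map-≤ : {g : Fin m → ℕ} {c : ℕ} {xs : List (Fin m)} → All (λ i → g i ≤ c) xs →
            sum (map g xs) ≤ length xs * c
sum-map-≤ []          = z≤n
sum-map-≤ (g≤c ∷ rest) = +-mono-≤ g≤c (sum-map-≤ rest)

sum-distinct≤sumF : (g : Fin m → ℕ) {xs : List (Fin m)} → Unique xs → sum (map g xs) ≤ sumF g
sum-distinct≤sumF g []                   = z≤n
sum-distinct≤sumF g {x ∷ xs} (x∉xs ∷ xs!) = begin
  g x + sum (map g xs)    ≤⟨ +-monoʳ-≤ (g x) (sum-map-mono (All.map unchanged x∉xs)) ⟩
  g x + sum (map g′ xs)   ≤⟨ +-monoʳ-≤ (g x) (sum-distinct≤sumF g′ xs!) ⟩
  g x + sumF g′           ≡⟨ sym (sumF-split g x) ⟩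
  sumF g                  ∎
  where
  open ≤-Reasoning
  g′ = updateAt g x (const 0)
  unchanged : ∀ {i} → x ≢ i → g i ≤ g′ i
  unchanged x≢i = ≤-reflexive (sym (updateAt-minimal _ x g (≢-sym x≢i)))

sumF≤sum-support : (g : Fin m → ℕ) (xs : List (Fin m)) → (∀ i → i ∉ xs → g i ≡ 0) →
                   sumF g ≤ sum (map g xs)
sumF≤sum-support g [] vanish = ≤-reflexive (sumF-zero (λ i → vanish i λ ()))
sumF≤sum-support g (x ∷ xs) vanish = begin
  sumF g                  ≡⟨ sumF-split g x ⟩
  g x + sumF g′           ≤⟨ +-monoʳ-≤ (g x) (sumF≤sum-support g′ xs vanish′) ⟩
  g x + sum (map g′ xs)   ≤⟨ +-monoʳ-≤ (g x) (sum-map-mono {xs = xs} (All.tabulate λ _ → updateAt-0-≤ g x _)) ⟩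
  g x + sum (map g xs)    ∎
  where
  open ≤-Reasoning
  g′ = updateAt g x (const 0)
  vanish′ : ∀ i → i ∉ xs → g′ i ≡ 0
  vanish′ i i∉xs with i ≟ x
  ... | yes refl = updateAt-updates x g
  ... | no i≢x   = trans (updateAt-minimal i x g i≢x)
                         (vanish i λ { (here i≡x) → i≢x i≡x ; (there i∈xs) → i∉xs i∈xs })

_∈?_ : (i : Fin m) (xs : List (Fin m)) → Dec (i ∈ xs)
i ∈? xs = Any.any? (i ≟_) xs

listSet : List (Fin m) → Fin m → Bool
listSet xs i = does (i ∈? xs)

listSet-member : {i : Fin m} {xs : List (Fin m)} → i ∈ xs → listSet xs i ≡ true
listSet-member {i = i} {xs} = dec-true (i ∈? xs)

indicator : Bool → ℕ
indicator b = if b then 1 else 0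

indicator≤1 : ∀ b → indicator b ≤ 1
indicator≤1 true  = ≤-refl
indicator≤1 false = z≤n

count : (Fin m → Bool) → ℕ
count S = sumF (indicator ∘ S)

count-listSet≤length : (xs : List (Fin m)) → count (listSet xs) ≤ length xs
count-listSet≤length xs = begin
  count (listSet xs)
    ≤⟨ sumF≤sum-support _ xs (λ i i∉xs → cong indicator (dec-false (i ∈? xs) i∉xs)) ⟩
  sum (map (indicator ∘ listSet xs) xs)
    ≤⟨ sum-map-≤ {xs = xs} (All.tabulate λ {i} _ → indicator≤1 (listSet xs i)) ⟩
  length xs * 1
    ≡⟨ *-identityʳ (length xs) ⟩
  length xs
    ∎
  where open ≤-Reasoning

all≡⊎another : {P : Fin m → Set} → (∀ i → Dec (P i)) → (a : Fin m) →
               (∀ i → P i → i ≡ a) ⊎ ∃[ b ] (b ≢ a × P b)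
all≡⊎another {P = P} P? a with any? (λ b → ¬? (b ≟ a) ×-dec P? b)
... | yes (b , b≢a , Pb) = inj₂ (b , b≢a , Pb)
... | no none = inj₁ only-a
  where
  only-a : ∀ i → P i → i ≡ a
  only-a i Pi with i ≟ a
  ... | yes i≡a = i≡a
  ... | no i≢a  = contradiction (i , i≢a , Pi) none

pairCover : (d : Fin m) (S : Fin m → Bool) → count S ≤ 2 →
            ∃₂ λ a b → ∀ i → S i ≡ true → i ∈ a ∷ b ∷ []
pairCover d S small with any? (λ i → S i ≟ᵇ true)
... | no empty = d , d , λ i Si → contradiction (i , Si) empty
... | yes (a , Sa) with all≡⊎another (λ i → S i ≟ᵇ true) a
...   | inj₁ only-a = a , a , λ i Si → here (only-a i Si)
...   | inj₂ (b , b≢a , Sb) = a , b , cover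
  where
  counted : ∀ {i} → S i ≡ true → 1 ≤ indicator (S i)
  counted Si rewrite Si = ≤-refl
  cover : ∀ i → S i ≡ true → i ∈ a ∷ b ∷ []
  cover i Si with i ≟ a | i ≟ b
  ... | yes i≡a | _       = here i≡a
  ... | no _    | yes i≡b = there (here i≡b)
  ... | no i≢a  | no i≢b  = contradiction three≤count (≤⇒≯ small)
    where
    a,b,i! : Unique (a ∷ b ∷ i ∷ [])
    a,b,i! = (≢-sym b≢a ∷ ≢-sym i≢a ∷ []) ∷ (≢-sym i≢b ∷ []) ∷ [] ∷ []
    three≤count : 3 ≤ count S
    three≤count = ≤-trans (sum-map-mono {g = const 1} {h = indicator ∘ S} (counted Sa ∷ counted Sb ∷ counted Si ∷ []))
                          (sum-distinct≤sumF (indicator ∘ S) a,b,i!)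

romanOn : List (Fin m) → List (Fin m) → Fin m → Fin 3
romanOn twos ones i with i ∈? twos | i ∈? ones
... | yes _ | _     = 2F
... | no _  | yes _ = 1F
... | no _  | no _  = 0F

module _ {twos ones : List (Fin m)} where

  romanOn-two : ∀ {i} → i ∈ twos → toℕ (romanOn twos ones i) ≡ 2
  romanOn-two {i} i∈twos with i ∈? twos | i ∈? ones
  ... | yes _     | _ = refl
  ... | no i∉twos | _ = contradiction i∈twos i∉twos

  romanOn-one : ∀ {i} → i ∉ twos → i ∈ ones → toℕ (romanOn twos ones i) ≡ 1
  romanOn-one {i} i∉twos i∈ones with i ∈? twos | i ∈? ones
  ... | yes i∈twos | _         = contradiction i∈twos i∉twos
  ... | no _       | yes _     = refl
  ... | no _       | no i∉ones = contradiction i∈ones i∉ones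

  romanOn-positive : ∀ {i} → i ∈ twos ⊎ i ∈ ones → 0 < toℕ (romanOn twos ones i)
  romanOn-positive {i} i∈ with i ∈? twos | i ∈? ones
  ... | yes _     | _         = s≤s z≤n
  ... | no _      | yes _     = s≤s z≤n
  ... | no i∉twos | no i∉ones =
    contradiction i∈ λ { (inj₁ i∈twos) → i∉twos i∈twos ; (inj₂ i∈ones) → i∉ones i∈ones }

  romanOn-support : ∀ {i} → 0 < toℕ (romanOn twos ones i) → i ∈ twos ⊎ i ∈ ones
  romanOn-support {i} i↦+ with i ∈? twos | i ∈? ones
  ... | yes i∈twos | _          = inj₁ i∈twos
  ... | no _       | yes i∈ones = inj₂ i∈ones
  ... | no _       | no _       = contradiction i↦+ λ ()

  romanOn-weight : All (_∉ twos) ones → sumF (toℕ ∘ romanOn twos ones) ≤ length twos * 2 + length ones * 1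
  romanOn-weight ones∉twos = begin
    sumF value                                   ≤⟨ sumF≤sum-support value (twos ++ ones) vanish ⟩
    sum (map value (twos ++ ones))               ≡⟨ cong sum (map-++ value twos ones) ⟩
    sum (map value twos ++ map value ones)       ≡⟨ sum-++ (map value twos) (map value ones) ⟩
    sum (map value twos) + sum (map value ones)  ≤⟨ +-mono-≤ (sum-map-≤ {xs = twos} (All.tabulate λ _ → at-most-2))
                                                             (sum-map-≤ {xs = ones} (All.tabulate one)) ⟩
    length twos * 2 + length ones * 1            ∎
    where
    open ≤-Reasoning
    value : Fin m → ℕ
    value = toℕ ∘ romanOn twos ones
    at-most-2 : ∀ {i} → value i ≤ 2
    at-most-2 {i} = toℕ≤pred[n] (romanOn twos ones i)
    one : ∀ {i} → i ∈ ones → value i ≤ 1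
    one i∈ones = ≤-reflexive (romanOn-one (All.lookup ones∉twos i∈ones) i∈ones)
    vanish : ∀ i → i ∉ twos ++ ones → value i ≡ 0
    vanish i i∉ with i ∈? twos | i ∈? ones
    ... | yes i∈twos | _          = contradiction (∈-++⁺ˡ i∈twos) i∉
    ... | no _       | yes i∈ones = contradiction (∈-++⁺ʳ twos i∈ones) i∉
    ... | no _       | no _       = refl

Dominates : (G : Graph) → List (V G) → Set
Dominates G xs = ∀ v → v ∈ xs ⊎ ∃[ u ] (u ∈ xs × Adj G v u)

TotallyDominates : (G : Graph) → List (V G) → Set
TotallyDominates G xs = ∀ v → ∃[ u ] (u ∈ xs × Adj G v u)

module _ (G : Graph) where

  adj⇒≢ : ∀ {u v} → Adj G u v → u ≢ v
  adj⇒≢ uv refl = irrefl G uv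

  withinDist2-cases : ∀ {u v} → WithinDist G 2 u v →
                      u ≡ v ⊎ Adj G u v ⊎ ∃[ c ] (Adj G u c × Adj G c v)
  withinDist2-cases here                     = inj₁ refl
  withinDist2-cases (step uv here)           = inj₂ (inj₁ uv)
  withinDist2-cases (step uc (step cv here)) = inj₂ (inj₂ (_ , uc , cv))

  dominating-cover : ∀ {S xs} → IsDominating G S → (∀ i → S i ≡ true → i ∈ xs) → Dominates G xs
  dominating-cover S-dom cover v with S-dom v
  ... | inj₁ v∈S            = inj₁ (cover v v∈S)
  ... | inj₂ (u , u∈S , vu) = inj₂ (u , cover u u∈S , vu)

  listSet-totallyDominating : ∀ {xs} → TotallyDominates G xs → IsTotalDominating G (listSet xs)
  listSet-totallyDominating td v with td v
  ... | u , u∈xs , vu = u , listSet-member u∈xs , vu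

  totalDominating⇒dominating : ∀ {S} → IsTotalDominating G S → IsDominating G S
  totalDominating⇒dominating td v = inj₂ (td v)

  dominates-⊆ : ∀ {xs ys} → xs ⊆ ys → Dominates G xs → Dominates G ys
  dominates-⊆ xs⊆ys dom v with dom v
  ... | inj₁ v∈xs            = inj₁ (xs⊆ys v∈xs)
  ... | inj₂ (u , u∈xs , vu) = inj₂ (u , xs⊆ys u∈xs , vu)

  totallyDominates⇒γt< : ∀ {xs} → TotallyDominates G xs → γt< G (suc (length xs))
  totallyDominates⇒γt< {xs} td = listSet xs , listSet-totallyDominating td , s≤s (count-listSet≤length xs)

  totallyDominates⇒γ< : ∀ {xs} → TotallyDominates G xs → γ< G (suc (length xs))
  totallyDominates⇒γ< td with totallyDominates⇒γt< td
  ... | S , S-td , small = S , totalDominating⇒dominating S-td , small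

  romanOn-isTRDF : {twos ones : List (V G)} → Dominates G twos →
                   (∀ w → w ∈ twos ⊎ w ∈ ones → ∃[ u ] ((u ∈ twos ⊎ u ∈ ones) × Adj G w u)) →
                   IsTRDF G (romanOn twos ones)
  romanOn-isTRDF {twos} {ones} dom linked = zero-dominated , positive-linked
    where
    zero-dominated : ∀ v → toℕ (romanOn twos ones v) ≡ 0 →
                     ∃[ u ] (Adj G v u × toℕ (romanOn twos ones u) ≡ 2)
    zero-dominated v v↦0 with dom v
    ... | inj₁ v∈twos           = contradiction (trans (sym v↦0) (romanOn-two v∈twos)) λ ()
    ... | inj₂ (u , u∈twos , vu) = u , vu , romanOn-two u∈twos
    positive-linked : ∀ w → 0 < toℕ (romanOn twos ones w) →
                      ∃[ u ] (Adj G w u × 0 < toℕ (romanOn twos ones u))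
    positive-linked w w↦+ with linked w (romanOn-support w↦+)
    ... | u , u∈ , wu = u , wu , romanOn-positive u∈

  positive⇒TRDF : NoIsolated G → {f : V G → Fin 3} → (∀ v → 0 < toℕ (f v)) → IsTRDF G f
  positive⇒TRDF noIso positive =
    (λ v v↦0 → contradiction v↦0 (n>0⇒n≢0 (positive v))) ,
    (λ w _ → proj₁ (noIso w) , proj₂ (noIso w) , positive (proj₁ (noIso w)))

module _ (H : Graph) {f : V H → Fin 3} (trdf : IsTRDF H f) (light : weight {H} f ≤ 4) where

  private
    g : V H → ℕ
    g = toℕ ∘ f

    heavy⇒positive : ∀ {i} → g i ≡ 2 → 0 < g i
    heavy⇒positive i↦2 = subst (0 <_) (sym i↦2) (s≤s z≤n)

    overweight : {xs : List (V H)} → Unique xs → 5 ≤ sum (map g xs) → ⊥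
    overweight xs! heavy = ≤⇒≯ light (≤-trans heavy (sum-distinct≤sumF g xs!))

    ¬twoHeavyOnePositive : ∀ {a b c} → a ≢ b → a ≢ c → b ≢ c → g a ≡ 2 → g b ≡ 2 → 0 < g c → ⊥
    ¬twoHeavyOnePositive a≢b a≢c b≢c a↦2 b↦2 c↦+ =
      overweight ((a≢b ∷ a≢c ∷ []) ∷ (b≢c ∷ []) ∷ [] ∷ [])
        (+-mono-≤ (≤-reflexive (sym a↦2)) (+-mono-≤ (≤-reflexive (sym b↦2)) (+-mono-≤ c↦+ z≤n)))

    ¬oneHeavyThreePositive : ∀ {a b c d} → a ≢ b → a ≢ c → a ≢ d → b ≢ c → b ≢ d → c ≢ d →
                             g a ≡ 2 → 0 < g b → 0 < g c → 0 < g d → ⊥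
    ¬oneHeavyThreePositive a≢b a≢c a≢d b≢c b≢d c≢d a↦2 b↦+ c↦+ d↦+ =
      overweight ((a≢b ∷ a≢c ∷ a≢d ∷ []) ∷ (b≢c ∷ b≢d ∷ []) ∷ (c≢d ∷ []) ∷ [] ∷ [])
        (+-mono-≤ (≤-reflexive (sym a↦2)) (+-mono-≤ b↦+ (+-mono-≤ c↦+ (+-mono-≤ d↦+ z≤n))))

    twoHeavy⇒totallyDominates : ∀ {a b} → b ≢ a → g a ≡ 2 → g b ≡ 2 → TotallyDominates H (a ∷ b ∷ [])
    twoHeavy⇒totallyDominates {a} {b} b≢a a↦2 b↦2 w with g w ≟ℕ 0
    ... | yes w↦0 with proj₁ trdf w w↦0
    ...   | u , wu , u↦2 with u ≟ a | u ≟ b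
    ...     | yes refl | _        = a , here refl , wu
    ...     | no _     | yes refl = b , there (here refl) , wu
    ...     | no u≢a   | no u≢b   =
      ⊥-elim (¬twoHeavyOnePositive (≢-sym b≢a) (≢-sym u≢a) (≢-sym u≢b) a↦2 b↦2 (heavy⇒positive u↦2))
    twoHeavy⇒totallyDominates {a} {b} b≢a a↦2 b↦2 w | no w≢0 with proj₂ trdf w (n≢0⇒n>0 w≢0)
    ... | z , wz , z↦+ with z ≟ a | z ≟ b
    ...   | yes refl | _        = a , here refl , wz
    ...   | no _     | yes refl = b , there (here refl) , wz
    ...   | no z≢a   | no z≢b   =
      ⊥-elim (¬twoHeavyOnePositive (≢-sym b≢a) (≢-sym z≢a) (≢-sym z≢b) a↦2 b↦2 z↦+)

    oneHeavy⇒totallyDominates : ∀ {a} → g a ≡ 2 → (∀ i → g i ≡ 2 → i ≡ a) →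
                                ∃[ x ] TotallyDominates H (a ∷ x ∷ [])
    oneHeavy⇒totallyDominates {a} a↦2 only-a with proj₂ trdf a (heavy⇒positive a↦2)
    ... | x , ax , x↦+ = x , dominated
      where
      dominated : TotallyDominates H (a ∷ x ∷ [])
      dominated w with g w ≟ℕ 0
      ... | yes w↦0 with proj₁ trdf w w↦0
      ...   | u , wu , u↦2 with only-a u u↦2
      ...     | refl = a , here refl , wu
      dominated w | no w≢0 with w ≟ a | w ≟ x
      ... | yes refl | _        = x , there (here refl) , ax
      ... | no _     | yes refl = a , here refl , symm H ax
      ... | no w≢a   | no w≢x with proj₂ trdf w (n≢0⇒n>0 w≢0)
      ...   | z , wz , z↦+ with z ≟ a | z ≟ x
      ...     | yes refl | _        = a , here refl , wz
      ...     | no _     | yes refl = x , there (here refl) , wz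
      ...     | no z≢a   | no z≢x   = ⊥-elim (¬oneHeavyThreePositive
                  (≢-sym w≢a) (≢-sym z≢a) (adj⇒≢ H ax) (adj⇒≢ H wz) w≢x z≢x a↦2 (n≢0⇒n>0 w≢0) z↦+ x↦+)

  lightTRDF⇒totallyDominatingPair : ∀ {w₀} → toℕ (f w₀) ≡ 0 → ∃₂ λ p q → TotallyDominates H (p ∷ q ∷ [])
  lightTRDF⇒totallyDominatingPair {w₀} w₀↦0 with proj₁ trdf w₀ w₀↦0
  ... | a , _ , a↦2 with all≡⊎another (λ i → g i ≟ℕ 2) a
  ...   | inj₁ only-a          = a , oneHeavy⇒totallyDominates a↦2 only-a
  ...   | inj₂ (b , b≢a , b↦2) = a , b , twoHeavy⇒totallyDominates b≢a a↦2 b↦2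

module Supercritical (G : Graph) (noIso : NoIsolated G) (γtR≥6 : ∀ f → IsTRDF G f → 6 ≤ weight {G} f)
                     (diam≤2 : ∀ u v → WithinDist G 2 u v) where

  ¬TRDF≤5 : ∀ {f} → IsTRDF G f → weight {G} f ≤ 5 → ⊥
  ¬TRDF≤5 trdf light = ≤⇒≯ light (γtR≥6 _ trdf)

  nonEdge⇒commonNeighbour : ∀ {u v} → NonEdge G u v → ∃[ c ] (Adj G u c × Adj G c v)
  nonEdge⇒commonNeighbour {u} {v} (u≢v , ¬uv) with withinDist2-cases G (diam≤2 u v)
  ... | inj₁ u≡v        = contradiction u≡v u≢v
  ... | inj₂ (inj₁ uv)  = contradiction uv ¬uv
  ... | inj₂ (inj₂ ucv) = ucv

  ¬adjacentDominatingPair : ∀ {a b} → Adj G a b → ¬ Dominates G (a ∷ b ∷ [])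
  ¬adjacentDominatingPair {a} {b} ab dom = ¬TRDF≤5 (romanOn-isTRDF G dom linked) light
    where
    linked : ∀ w → w ∈ a ∷ b ∷ [] ⊎ w ∈ [] → ∃[ u ] ((u ∈ a ∷ b ∷ [] ⊎ u ∈ []) × Adj G w u)
    linked _ (inj₁ (here refl))         = b , inj₁ (there (here refl)) , ab
    linked _ (inj₁ (there (here refl))) = a , inj₁ (here refl) , symm G ab
    light : weight {G} (romanOn (a ∷ b ∷ []) []) ≤ 5
    light = ≤-trans (romanOn-weight {twos = a ∷ b ∷ []} {ones = []} []) (n≤1+n 4)

  ¬dominatingPair : ∀ a b → ¬ Dominates G (a ∷ b ∷ [])
  ¬dominatingPair a b dom with withinDist2-cases G (diam≤2 a b)
  ... | inj₁ refl = ¬adjacentDominatingPair (proj₂ (noIso a))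
                      (dominates-⊆ G (λ { (here refl) → here refl ; (there (here refl)) → here refl }) dom)
  ... | inj₂ (inj₁ ab) = ¬adjacentDominatingPair ab dom
  ... | inj₂ (inj₂ (c , ac , cb)) = ¬TRDF≤5 (romanOn-isTRDF G dom linked) light
    where
    linked : ∀ w → w ∈ a ∷ b ∷ [] ⊎ w ∈ c ∷ [] → ∃[ u ] ((u ∈ a ∷ b ∷ [] ⊎ u ∈ c ∷ []) × Adj G w u)
    linked _ (inj₁ (here refl))         = c , inj₂ (here refl) , ac
    linked _ (inj₁ (there (here refl))) = c , inj₂ (here refl) , symm G cb
    linked _ (inj₂ (here refl))         = a , inj₁ (here refl) , symm G ac
    c∉ab : c ∉ a ∷ b ∷ []
    c∉ab (here refl)         = irrefl G ac
    c∉ab (there (here refl)) = irrefl G cb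
    light : weight {G} (romanOn (a ∷ b ∷ []) (c ∷ [])) ≤ 5
    light = romanOn-weight {twos = a ∷ b ∷ []} {ones = c ∷ []} (c∉ab ∷ [])

  γ≥3 : V G → ∀ S → IsDominating G S → 3 ≤ size G S
  γ≥3 d S S-dom with 3 ≤? size G S
  ... | yes 3≤|S| = 3≤|S|
  ... | no 3≰|S| with pairCover d S (≤-pred (≰⇒> 3≰|S|))
  ...   | a , b , cover = ⊥-elim (¬dominatingPair a b (dominating-cover G S-dom cover))

  γt≥3 : V G → ∀ S → IsTotalDominating G S → 3 ≤ size G S
  γt≥3 d S S-td = γ≥3 d S (totalDominating⇒dominating G S-td)

  addEdge⇒totallyDominatingPair : ∀ {u v} (u≢v : u ≢ v) → γtR≤ (addEdge G u v u≢v) 4 →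
                                  ∃₂ λ p q → TotallyDominates (addEdge G u v u≢v) (p ∷ q ∷ [])
  addEdge⇒totallyDominatingPair u≢v (f , trdf , light) with any? (λ w → toℕ (f w) ≟ℕ 0)
  ... | yes (w₀ , w₀↦0) = lightTRDF⇒totallyDominatingPair (addEdge G _ _ u≢v) trdf light w₀↦0
  ... | no none = ⊥-elim (¬TRDF≤5 (positive⇒TRDF G noIso (λ w → n≢0⇒n>0 λ w↦0 → none (w , w↦0)))
                                  (≤-trans light (n≤1+n 4)))

  totallyDominates-addEdge⁻ : ∀ {u v xs} (uv : NonEdge G u v) → TotallyDominates (addEdge G u v (proj₁ uv)) xs →
                              ∃[ z ] TotallyDominates G (z ∷ xs)
  totallyDominates-addEdge⁻ {u} {v} {xs} uv td = z , dominated
    where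
    witness : Dec (v ∈ xs) → Dec (u ∈ xs) → ∃[ z ] ((v ∈ xs → Adj G u z) × (u ∈ xs → Adj G v z))
    witness (yes _) (yes _) with nonEdge⇒commonNeighbour uv
    ... | c , uc , cv = c , const uc , const (symm G cv)
    witness (yes _)   (no u∉xs) = proj₁ (noIso u) , const (proj₂ (noIso u)) , flip contradiction u∉xs
    witness (no v∉xs) (yes _)   = proj₁ (noIso v) , flip contradiction v∉xs , const (proj₂ (noIso v))
    witness (no v∉xs) (no u∉xs) = u , flip contradiction v∉xs , flip contradiction u∉xs
    z = proj₁ (witness (v ∈? xs) (u ∈? xs))
    z-for-u = proj₁ (proj₂ (witness (v ∈? xs) (u ∈? xs)))
    z-for-v = proj₂ (proj₂ (witness (v ∈? xs) (u ∈? xs)))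
    dominated : TotallyDominates G (z ∷ xs)
    dominated w with td w
    ... | s , s∈xs , inj₁ ws                     = s , there s∈xs , ws
    ... | s , s∈xs , inj₂ (inj₁ (refl , refl)) = z , here refl , z-for-u s∈xs
    ... | s , s∈xs , inj₂ (inj₂ (refl , refl)) = z , here refl , z-for-v s∈xs

  γt≡3 : ∀ {u v} (uv : NonEdge G u v) → γtR≤ (addEdge G u v (proj₁ uv)) 4 → γt≡ G 3
  γt≡3 {u} uv light with addEdge⇒totallyDominatingPair (proj₁ uv) light
  ... | p , q , td with totallyDominates-addEdge⁻ uv td
  ...   | z , td′ = (T , T-td , ≤-antisym |T|≤3 (γt≥3 u T T-td)) , γt≥3 u
    where
    |T|≤3 = count-listSet≤length (z ∷ p ∷ q ∷ [])
    T = listSet (z ∷ p ∷ q ∷ [])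
    T-td = listSet-totallyDominating G td′

  γ≡3 : ∀ {u v} (uv : NonEdge G u v) → γtR≤ (addEdge G u v (proj₁ uv)) 4 → γ≡ G 3
  γ≡3 {u} uv light with γt≡3 uv light
  ... | (T , T-td , |T|≡3) , _ = (T , totalDominating⇒dominating G T-td , |T|≡3) , γ≥3 u

  γt<3 : ∀ {u v} (u≢v : u ≢ v) → γtR≤ (addEdge G u v u≢v) 4 → γt< (addEdge G u v u≢v) 3
  γt<3 u≢v light with addEdge⇒totallyDominatingPair u≢v light
  ... | _ , _ , td = totallyDominates⇒γt< (addEdge G _ _ u≢v) td

  γ<3 : ∀ {u v} (u≢v : u ≢ v) → γtR≤ (addEdge G u v u≢v) 4 → γ< (addEdge G u v u≢v) 3
  γ<3 u≢v light with addEdge⇒totallyDominatingPair u≢v light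
  ... | _ , _ , td = totallyDominates⇒γ< (addEdge G _ _ u≢v) td

lemma10p3 : (G : Graph) → Connected G → TRSupercritical 6 G → Diam≡ G 2
    → TotalCritical 3 G × DomCritical 3 G
lemma10p3 G _ (noIso , (_ , γtR≥6) , cne@(u , v , uv) , supercritical) (diam≤2 , _) =
    (noIso , γt≡3 uv (supercritical u v uv) , cne , λ x y xy → γt<3 (proj₁ xy) (supercritical x y xy))
  , (γ≡3 uv (supercritical u v uv) , cne , λ x y xy → γ<3 (proj₁ xy) (supercritical x y xy))
  where open Supercritical G noIso γtR≥6 diam≤2
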